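{- Let $\mathcal M=(M,\le,{}^\perp)$ be a complete orthomodular lattice and let $L$ be an involutive submonoid of $\mathbf{Lin}(\mathcal M)$ containing all Sasaki projections $\pi_m$ ($m\in M$). Then $\mathscr P(L)=(\mathscr P(L),\bigcup,\odot,{}^*,{\sim},\{\mathrm{id}_M\})$ is an involutive generalized dynamic algebra.
   Context: An orthomodular lattice $(M,\le,{}^\perp)$ is a bounded lattice with ${}^\perp$ such that $m\wedge m^\perp=0$, $m\vee m^\perp=1$, $m\le n\Rightarrow n^\perp\le m^\perp$, $m^{\perp\perp}=m$, and $m\le n\Rightarrow n=m\vee(m^\perp\wedge n)$. Sasaki projection: $\pi_m(x)=m\wedge(m^\perp\vee x)$. A map $f:M\to M$ is linear if there is $f^*:M\to M$ (unique) with $f(x)\le y^\perp\iff x\le(f^*(y))^\perp$ for all $x,y$; $\mathbf{Lin}(\mathcal M)$ is the set of linear maps, an involutive monoid under $\circ$, $f\mapsto f^*$, $\mathrm{id}_M$; each $\pi_m$ is linear and $\pi_m^*=\pi_m$. $\mathscr P(L)$: all subsets of $L$, with join = union, $A\odot B=\{a\circ b\}$, $A^*=\{a^*:a\in A\}$, ${\sim}A=\{\pi_{(\bigvee_{a\in A}a(1))^\perp}\}$, unit $\{\mathrm{id}_M\}$; $(\mathscr P(L),\bigcup,\odot,{}^*,\{\mathrm{id}_M\})$ is a unital involutive quantale. An involutive generalized dynamic algebra is $(K,\bigsqcup,\odot,{}^*,{\sim},e)$ where $(K,\bigsqcup,\odot,{}^*,e)$ is a unital involutive quantale (complete join-semilattice,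 associative $\odot$ distributing over arbitrary joins on both sides, unit $e$, involution reversing products and preserving arbitrary joins) and ${\sim}:K\to K$ satisfies for all $x,y$ and all families $(x_i)$: (i) ${\sim}(x\odot{\sim}{\sim}y)={\sim}(x\odot y)$; (ii) ${\sim}(\bigsqcup_i{\sim}{\sim}x_i)={\sim}(\bigsqcup_i x_i)$; (iii) $({\sim}x)^*={\sim}x$; (iv) ${\sim}{\sim}({\sim}{\sim}x\odot y)={\sim}({\sim}x\sqcup{\sim}({\sim}x\sqcup y))$, where $\sqcup$ is binary join. -}

module Defs where

open import Level using (Level; _⊔_) renaming (suc to lsuc; zero to lzero)
open import Data.Bool using (Bool; true; false; if_then_else_)
open import Data.Product using (Σ; ∃; ∃-syntax; _×_; _,_)
open import Function using (_∘_; id)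
open import Function.Bundles using (_⇔_)
open import Relation.Binary.Core using (Rel)
open import Relation.Binary.Structures using (IsPartialOrder)
open import Relation.Binary.Lattice.Structures using (IsBoundedLattice)
open import Relation.Binary.PropositionalEquality using (_≡_; _≗_)

record CompleteOrthomodularLattice : Set₁ where
  infix 4 _≤_
  infixr 7 _∧_
  infixr 6 _∨_
  field
    M    : Set
    _≤_  : M → M → Set
    _∧_  : M → M → M
    _∨_  : M → M → M
    𝟙    : M
    𝟘    : M
    _ᗮ   : M → M
    isBoundedLattice : IsBoundedLattice _≡_ _≤_ _∨_ _∧_ 𝟙 𝟘
    compl-∧   : ∀ m → m ∧ (m ᗮ) ≡ 𝟘
    compl-∨   : ∀ m → m ∨ (m ᗮ) ≡ 𝟙
    antitone  : ∀ {m n} → m ≤ n → n ᗮ ≤ m ᗮ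
    involutive : ∀ m → (m ᗮ) ᗮ ≡ m
    orthomodular : ∀ {m n} → m ≤ n → n ≡ m ∨ ((m ᗮ) ∧ n)
    ⋁ : (M → Set) → M
    ⋁-upper : ∀ (S : M → Set) m → S m → m ≤ ⋁ S
    ⋁-least : ∀ (S : M → Set) z → (∀ m → S m → m ≤ z) → ⋁ S ≤ z

  π : M → M → M
  π m x = m ∧ ((m ᗮ) ∨ x)

  IsAdjoint : (M → M) → (M → M) → Set
  IsAdjoint f g = ∀ x y → (f x ≤ y ᗮ) ⇔ (x ≤ (g y) ᗮ)

  Linear : (M → M) → Set
  Linear f = Σ (M → M) (IsAdjoint f)

-- Involutive submonoids of Lin(M) containing all Sasaki projections.
-- A subset L of the maps M → M is a predicate; since maps are
-- identified extensionally, L is required to be closed under ≗.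

record InvolutiveSubmonoidWithSasaki (𝓜 : CompleteOrthomodularLattice) : Set₁ where
  open CompleteOrthomodularLattice 𝓜
  field
    L       : (M → M) → Set
    L-ext   : ∀ {f g} → f ≗ g → L f → L g
    L-lin   : ∀ {f} → L f → Linear f
    L-id    : L id
    L-∘     : ∀ {f g} → L f → L g → L (f ∘ g)
    L-*     : ∀ {f g} → L f → IsAdjoint f g → L g
    L-π     : ∀ m → L (π m)

module PowerSet {𝓜 : CompleteOrthomodularLattice}
                (𝓛 : InvolutiveSubmonoidWithSasaki 𝓜) where
  open CompleteOrthomodularLattice 𝓜
  open InvolutiveSubmonoidWithSasaki 𝓛

  record 𝒫L : Set₁ where
    constructor subset
    field
      _∋_  : (M → M) → Set
      ∋-ext : ∀ {f g} → f ≗ g → _∋_ f → _∋_ g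
      ∋-L   : ∀ {f} → _∋_ f → L f
  open 𝒫L public

  _⊆_ : 𝒫L → 𝒫L → Set
  A ⊆ B = ∀ f → A ∋ f → B ∋ f

  _≐_ : 𝒫L → 𝒫L → Set
  A ≐ B = (A ⊆ B) × (B ⊆ A)

  ⋃ : {I : Set} → (I → 𝒫L) → 𝒫L
  ⋃ {I} A = subset (λ f → Σ I (λ i → A i ∋ f))
                   (λ { eq (i , p) → i , ∋-ext (A i) eq p })
                   (λ { (i , p) → ∋-L (A i) p })

  _⊙_ : 𝒫L → 𝒫L → 𝒫L
  A ⊙ B = subset (λ h → ∃[ a ] ∃[ b ] (A ∋ a × B ∋ b × h ≗ a ∘ b))
                 (λ { {h} {h'} eq (a , b , p , q , e) →
                      a , b , p , q , λ x → Relation.Binary.PropositionalEquality.trans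
                                              (Relation.Binary.PropositionalEquality.sym (eq x)) (e x) })
                 (λ { (a , b , p , q , e) →
                      L-ext (λ x → Relation.Binary.PropositionalEquality.sym (e x))
                            (L-∘ (∋-L A p) (∋-L B q)) })

  _* : 𝒫L → 𝒫L
  A * = subset (λ g → ∃[ a ] (A ∋ a × IsAdjoint a g))
               (λ { {g} {g'} eq (a , p , adj) →
                    a , p , λ x y → Relation.Binary.PropositionalEquality.subst
                                      (λ t → (a x ≤ y ᗮ) ⇔ (x ≤ t ᗮ)) (eq y) (adj x y) })
               (λ { (a , p , adj) → L-* (∋-L A p) adj })

  ∼ : 𝒫L → 𝒫L
  ∼ A = subset (λ h → h ≗ π (c ᗮ))
               (λ { eq e x → Relation.Binary.PropositionalEquality.trans
                               (Relation.Binary.PropositionalEquality.sym (eq x)) (e x) })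
               (λ e → L-ext (λ x → Relation.Binary.PropositionalEquality.sym (e x)) (L-π (c ᗮ)))
    where
      c : M
      c = ⋁ (λ m → ∃[ a ] (A ∋ a × a 𝟙 ≡ m))

  ε : 𝒫L
  ε = subset (λ h → h ≗ id)
             (λ { eq e x → Relation.Binary.PropositionalEquality.trans
                             (Relation.Binary.PropositionalEquality.sym (eq x)) (e x) })
             (λ e → L-ext (λ x → Relation.Binary.PropositionalEquality.sym (e x)) L-id)

module _ {a ℓ₁ ℓ₂ : Level} {K : Set a} where

  binJoin : ({I : Set} → (I → K) → K) → K → K → K
  binJoin ⨆ x y = ⨆ {Bool} (λ b → if b then x else y)

  record IsInvolutiveGDA
    (_≈_ : Rel K ℓ₁) (_≤_ : Rel K ℓ₂)
    (⨆ : {I : Set} → (I → K) → K)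
    (_⊙_ : K → K → K) (_* : K → K) (∼ : K → K) (e : K)
    : Set (lsuc lzero ⊔ a ⊔ ℓ₁ ⊔ ℓ₂) where
    _⊔ₖ_ : K → K → K
    _⊔ₖ_ = binJoin ⨆
    field
      isPartialOrder : IsPartialOrder _≈_ _≤_
      ⨆-upper : ∀ {I : Set} (x : I → K) i → x i ≤ ⨆ x
      ⨆-least : ∀ {I : Set} (x : I → K) z → (∀ i → x i ≤ z) → ⨆ x ≤ z
      ⊙-cong : ∀ {x x' y y'} → x ≈ x' → y ≈ y' → (x ⊙ y) ≈ (x' ⊙ y')
      *-cong : ∀ {x x'} → x ≈ x' → (x *) ≈ (x' *)
      ∼-cong : ∀ {x x'} → x ≈ x' → ∼ x ≈ ∼ x'
      ⊙-assoc : ∀ x y z → ((x ⊙ y) ⊙ z) ≈ (x ⊙ (y ⊙ z))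
      ⊙-identityˡ : ∀ x → (e ⊙ x) ≈ x
      ⊙-identityʳ : ∀ x → (x ⊙ e) ≈ x
      ⊙-distribˡ-⨆ : ∀ {I : Set} x (y : I → K) → (x ⊙ ⨆ y) ≈ ⨆ (λ i → x ⊙ y i)
      ⊙-distribʳ-⨆ : ∀ {I : Set} (x : I → K) y → (⨆ x ⊙ y) ≈ ⨆ (λ i → x i ⊙ y)
      *-involutive : ∀ x → ((x *) *) ≈ x
      *-antihom    : ∀ x y → ((x ⊙ y) *) ≈ ((y *) ⊙ (x *))
      *-⨆          : ∀ {I : Set} (x : I → K) → (⨆ x *) ≈ ⨆ (λ i → x i *)
      ax-i   : ∀ x y → ∼ (x ⊙ ∼ (∼ y)) ≈ ∼ (x ⊙ y)
      ax-ii  : ∀ {I : Set} (x : I → K) → ∼ (⨆ (λ i → ∼ (∼ (x i)))) ≈ ∼ (⨆ x)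
      ax-iii : ∀ x → (∼ x *) ≈ ∼ x
      ax-iv  : ∀ x y → ∼ (∼ (∼ (∼ x) ⊙ y)) ≈ ∼ (∼ x ⊔ₖ ∼ (∼ x ⊔ₖ y))

-- ∼A = {π_{(supp A)ᗮ}} depends only on supp A = ⋁_{a ∈ A} a(1), and π_m(1) = m gives
-- supp (∼ A) = (supp A)ᗮ, so ∼∼ preserves supports.  Linear maps preserve joins, hence
-- supp (A ⊙ B) depends only on supp B; with these facts axioms (i) and (ii) are immediate,
-- and (iv) becomes De Morgan's law for π_m(n) = m ∧ (mᗮ ∨ n).  The orthomodular law makes
-- every Sasaki projection self-adjoint, which is axiom (iii).  The quantale laws are set
-- bookkeeping, and the involution laws follow from uniqueness of adjoints.
module Submission where

open import Defs
open import Data.Bool using (Bool; true; false; if_then_else_)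
open import Data.Product using (∃-syntax; _×_; _,_; proj₁; proj₂)
open import Function using (_∘_; id)
open import Function.Bundles using (_⇔_; mk⇔; Equivalence)
open import Relation.Binary.Lattice.Bundles using (Lattice)
open import Relation.Binary.Lattice.Structures using (IsBoundedLattice)
open import Relation.Binary.Structures using (IsPartialOrder)
open import Relation.Binary.PropositionalEquality
  using (_≡_; _≗_; refl; sym; trans; cong; cong₂; subst; module ≡-Reasoning)
import Relation.Binary.Lattice.Properties.JoinSemilattice as JoinSemilatticeProperties
import Relation.Binary.Lattice.Properties.MeetSemilattice as MeetSemilatticeProperties
import Relation.Binary.Reasoning.PartialOrder as PartialOrderReasoning

open Equivalence using (to; from)

module OrthomodularLatticeProperties (𝓜 : CompleteOrthomodularLattice) where
  open CompleteOrthomodularLattice 𝓜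
  open IsBoundedLattice isBoundedLattice public
    using (x≤x∨y; y≤x∨y; ∨-least; x∧y≤x; x∧y≤y; ∧-greatest; maximum)
    renaming (refl to ≤-refl; reflexive to ≤-reflexive; trans to ≤-trans; antisym to ≤-antisym)

  lattice : Lattice _ _ _
  lattice = record { isLattice = IsBoundedLattice.isLattice isBoundedLattice }

  open JoinSemilatticeProperties (Lattice.joinSemilattice lattice) public using (∨-monotonic)
  open MeetSemilatticeProperties (Lattice.meetSemilattice lattice) public using (∧-monotonic)
  module ≤-Reasoning = PartialOrderReasoning (Lattice.poset lattice)

  ≤ᗮ-sym : ∀ {a b} → a ≤ b ᗮ → b ≤ a ᗮ
  ≤ᗮ-sym {a} {b} p = subst (_≤ a ᗮ) (involutive b) (antitone p)

  ᗮ-injective : ∀ {a b} → a ᗮ ≡ b ᗮ → a ≡ b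
  ᗮ-injective {a} {b} e = trans (sym (involutive a)) (trans (cong _ᗮ e) (involutive b))

  ᗮ-∨ : ∀ a b → (a ∨ b) ᗮ ≡ a ᗮ ∧ b ᗮ
  ᗮ-∨ a b = ≤-antisym
    (∧-greatest (antitone (x≤x∨y a b)) (antitone (y≤x∨y a b)))
    (≤ᗮ-sym (∨-least (≤ᗮ-sym (x∧y≤x _ _)) (≤ᗮ-sym (x∧y≤y _ _))))

  ᗮ-∧ : ∀ a b → (a ∧ b) ᗮ ≡ a ᗮ ∨ b ᗮ
  ᗮ-∧ a b = ᗮ-injective (begin
    (a ∧ b) ᗮ ᗮ            ≡⟨ involutive _ ⟩
    a ∧ b                  ≡⟨ cong₂ _∧_ (involutive a) (involutive b) ⟨
    a ᗮ ᗮ ∧ b ᗮ ᗮ          ≡⟨ ᗮ-∨ (a ᗮ) (b ᗮ) ⟨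
    (a ᗮ ∨ b ᗮ) ᗮ          ∎)
    where open ≡-Reasoning

  π-𝟙 : ∀ m → π m 𝟙 ≡ m
  π-𝟙 m = ≤-antisym (x∧y≤x _ _) (∧-greatest ≤-refl (≤-trans (maximum m) (y≤x∨y _ _)))

  π-ᗮ : ∀ m x → π m x ᗮ ≡ m ᗮ ∨ (m ∧ x ᗮ)
  π-ᗮ m x = begin
    (m ∧ (m ᗮ ∨ x)) ᗮ      ≡⟨ ᗮ-∧ m _ ⟩
    m ᗮ ∨ (m ᗮ ∨ x) ᗮ      ≡⟨ cong (m ᗮ ∨_) (ᗮ-∨ (m ᗮ) x) ⟩
    m ᗮ ∨ (m ᗮ ᗮ ∧ x ᗮ)    ≡⟨ cong (λ t → m ᗮ ∨ (t ∧ x ᗮ)) (involutive m) ⟩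
    m ᗮ ∨ (m ∧ x ᗮ)        ∎
    where open ≡-Reasoning

  π-absorb : ∀ {m a} → a ≤ m → π m a ≡ a
  π-absorb {m} {a} a≤m = ᗮ-injective (begin
    π m a ᗮ                ≡⟨ π-ᗮ m a ⟩
    m ᗮ ∨ (m ∧ a ᗮ)        ≡⟨ cong (λ t → m ᗮ ∨ (t ∧ a ᗮ)) (involutive m) ⟨
    m ᗮ ∨ (m ᗮ ᗮ ∧ a ᗮ)    ≡⟨ orthomodular (antitone a≤m) ⟨
    a ᗮ                    ∎)
    where open ≡-Reasoning

  π-galois : ∀ {m x z} → (π m x ≤ z) ⇔ (x ≤ m ᗮ ∨ (m ∧ z))
  π-galois {m} {x} {z} = mk⇔ ⇒ ⇐
    where
      open ≤-Reasoning

      ⇒ : π m x ≤ z → x ≤ m ᗮ ∨ (m ∧ z)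
      ⇒ p = begin
        x                          ≤⟨ y≤x∨y (m ᗮ) x ⟩
        m ᗮ ∨ x                    ≡⟨ orthomodular (x≤x∨y (m ᗮ) x) ⟩
        m ᗮ ∨ (m ᗮ ᗮ ∧ (m ᗮ ∨ x))  ≡⟨ cong (λ t → m ᗮ ∨ (t ∧ (m ᗮ ∨ x))) (involutive m) ⟩
        m ᗮ ∨ π m x                ≤⟨ ∨-monotonic ≤-refl (∧-greatest (x∧y≤x _ _) p) ⟩
        m ᗮ ∨ (m ∧ z)              ∎

      ⇐ : x ≤ m ᗮ ∨ (m ∧ z) → π m x ≤ z
      ⇐ p = begin
        m ∧ (m ᗮ ∨ x)              ≤⟨ ∧-monotonic ≤-refl (∨-least (x≤x∨y _ _) p) ⟩
        π m (m ∧ z)                ≡⟨ π-absorb (x∧y≤x m z) ⟩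
        m ∧ z                      ≤⟨ x∧y≤y m z ⟩
        z                          ∎

  π-selfAdjoint : ∀ m → IsAdjoint (π m) (π m)
  π-selfAdjoint m x y = mk⇔
    (λ p → subst (x ≤_) (sym (π-ᗮ m y)) (to π-galois p))
    (λ q → from π-galois (subst (x ≤_) (π-ᗮ m y) q))

  IsAdjoint-sym : ∀ {f g} → IsAdjoint f g → IsAdjoint g f
  IsAdjoint-sym adj x y = mk⇔ (λ p → ≤ᗮ-sym (from (adj y x) (≤ᗮ-sym p)))
                              (λ q → ≤ᗮ-sym (to (adj y x) (≤ᗮ-sym q)))

  IsAdjoint-respˡ : ∀ {f f' g} → f ≗ f' → IsAdjoint f g → IsAdjoint f' g
  IsAdjoint-respˡ {g = g} f≗f' adj x y =
    subst (λ t → (t ≤ y ᗮ) ⇔ (x ≤ g y ᗮ)) (f≗f' x) (adj x y)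

  IsAdjoint-respʳ : ∀ {f g g'} → g ≗ g' → IsAdjoint f g → IsAdjoint f g'
  IsAdjoint-respʳ {f} g≗g' adj x y =
    subst (λ t → (f x ≤ y ᗮ) ⇔ (x ≤ t ᗮ)) (g≗g' y) (adj x y)

  adjoint-unique : ∀ {f g g'} → IsAdjoint f g → IsAdjoint f g' → g ≗ g'
  adjoint-unique adj adj' y = ᗮ-injective (≤-antisym
    (to (adj' _ y) (from (adj _ y) ≤-refl))
    (to (adj _ y) (from (adj' _ y) ≤-refl)))

  IsAdjoint-∘ : ∀ {f f* g g*} → IsAdjoint f f* → IsAdjoint g g* → IsAdjoint (f ∘ g) (g* ∘ f*)
  IsAdjoint-∘ adjf adjg x y =
    mk⇔ (λ p → to (adjg x _) (to (adjf _ y) p)) (λ q → from (adjf _ y) (from (adjg x _) q))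

  adjoint-residuation : ∀ {f g} → IsAdjoint f g → ∀ {a z} → (f a ≤ z) ⇔ (a ≤ g (z ᗮ) ᗮ)
  adjoint-residuation {f} adj {a} {z} = mk⇔
    (λ p → to (adj a (z ᗮ)) (subst (f a ≤_) (sym (involutive z)) p))
    (λ q → subst (f a ≤_) (involutive z) (from (adj a (z ᗮ)) q))

  adjoint-monotone : ∀ {f g} → IsAdjoint f g → ∀ {a b} → a ≤ b → f a ≤ f b
  adjoint-monotone adj a≤b =
    from (adjoint-residuation adj) (≤-trans a≤b (to (adjoint-residuation adj) ≤-refl))

module Support {𝓜 : CompleteOrthomodularLattice} (𝓛 : InvolutiveSubmonoidWithSasaki 𝓜) where
  open CompleteOrthomodularLattice 𝓜
  open InvolutiveSubmonoidWithSasaki 𝓛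
  open PowerSet 𝓛
  open OrthomodularLatticeProperties 𝓜

  supp : 𝒫L → M
  supp A = ⋁ (λ m → ∃[ a ] (A ∋ a × a 𝟙 ≡ m))

  supp-upper : ∀ A {a} → A ∋ a → a 𝟙 ≤ supp A
  supp-upper A {a} a∈A = ⋁-upper _ _ (a , a∈A , refl)

  supp-least : ∀ A {z} → (∀ a → A ∋ a → a 𝟙 ≤ z) → supp A ≤ z
  supp-least A {z} bound = ⋁-least _ z (λ { m (a , a∈A , refl) → bound a a∈A })

  supp-mono : ∀ {A B} → A ⊆ B → supp A ≤ supp B
  supp-mono {A} {B} A⊆B = supp-least A (λ a a∈A → supp-upper B (A⊆B a a∈A))

  supp-cong : ∀ {A B} → A ≐ B → supp A ≡ supp B
  supp-cong {A} {B} (A⊆B , B⊆A) = ≤-antisym (supp-mono {A} {B} A⊆B) (supp-mono {B} {A} B⊆A)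

  ∼-cong-supp : ∀ A B → supp A ≡ supp B → ∼ A ≐ ∼ B
  ∼-cong-supp A B e = (λ h h≗ x → trans (h≗ x) (cong (λ t → π (t ᗮ) x) e))
                    , (λ h h≗ x → trans (h≗ x) (cong (λ t → π (t ᗮ) x) (sym e)))

  supp-∼ : ∀ A → supp (∼ A) ≡ supp A ᗮ
  supp-∼ A = ≤-antisym
    (supp-least (∼ A) (λ h h≗ → ≤-reflexive (trans (h≗ 𝟙) (π-𝟙 _))))
    (subst (_≤ supp (∼ A)) (π-𝟙 _) (supp-upper (∼ A) {π (supp A ᗮ)} (λ _ → refl)))

  supp-∼∼ : ∀ A → supp (∼ (∼ A)) ≡ supp A
  supp-∼∼ A = trans (supp-∼ (∼ A)) (trans (cong _ᗮ (supp-∼ A)) (involutive _))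

  ∋-linear : ∀ A {f} → A ∋ f → Linear f
  ∋-linear A f∈A = L-lin (∋-L A f∈A)

  supp-⊙-apply : ∀ A B {a} → A ∋ a → a (supp B) ≤ supp (A ⊙ B)
  supp-⊙-apply A B {a} a∈A =
    let (_ , adj) = ∋-linear A a∈A in
    from (adjoint-residuation adj) (supp-least B (λ b b∈B →
      to (adjoint-residuation adj) (supp-upper (A ⊙ B) (a , b , a∈A , b∈B , λ _ → refl))))

  supp-⊙-monoʳ : ∀ A {B B'} → supp B ≤ supp B' → supp (A ⊙ B) ≤ supp (A ⊙ B')
  supp-⊙-monoʳ A {B} {B'} B≤B' = supp-least (A ⊙ B) λ { h (a , b , a∈A , b∈B , h≗) →
    let a-mono = adjoint-monotone (proj₂ (∋-linear A a∈A)) in begin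
      h 𝟙         ≡⟨ h≗ 𝟙 ⟩
      a (b 𝟙)     ≤⟨ a-mono (supp-upper B b∈B) ⟩
      a (supp B)  ≤⟨ a-mono B≤B' ⟩
      a (supp B') ≤⟨ supp-⊙-apply A B' a∈A ⟩
      supp (A ⊙ B') ∎ }
    where open ≤-Reasoning

  supp-⊙-congʳ : ∀ A {B B'} → supp B ≡ supp B' → supp (A ⊙ B) ≡ supp (A ⊙ B')
  supp-⊙-congʳ A {B} {B'} e =
    ≤-antisym (supp-⊙-monoʳ A {B} {B'} (≤-reflexive e)) (supp-⊙-monoʳ A {B'} {B} (≤-reflexive (sym e)))

  supp-⋃-mono : ∀ {I : Set} {A B : I → 𝒫L} → (∀ i → supp (A i) ≤ supp (B i)) →
                supp (⋃ A) ≤ supp (⋃ B)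
  supp-⋃-mono {A = A} {B} A≤B = supp-least (⋃ A) λ { a (i , a∈Aᵢ) →
    ≤-trans (supp-upper (A i) a∈Aᵢ)
      (≤-trans (A≤B i) (supp-least (B i) (λ b b∈Bᵢ → supp-upper (⋃ B) (i , b∈Bᵢ)))) }

  supp-⋃-cong : ∀ {I : Set} {A B : I → 𝒫L} → (∀ i → supp (A i) ≡ supp (B i)) →
                supp (⋃ A) ≡ supp (⋃ B)
  supp-⋃-cong {A = A} {B} e = ≤-antisym (supp-⋃-mono {A = A} {B} (λ i → ≤-reflexive (e i)))
                                       (supp-⋃-mono {A = B} {A} (λ i → ≤-reflexive (sym (e i))))

  _∪_ : 𝒫L → 𝒫L → 𝒫L
  A ∪ B = ⋃ {Bool} (λ b → if b then A else B)

  supp-∪ : ∀ A B → supp (A ∪ B) ≡ supp A ∨ supp B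
  supp-∪ A B = ≤-antisym
    (supp-least (A ∪ B) λ { h (true , h∈A) → ≤-trans (supp-upper A h∈A) (x≤x∨y _ _)
                          ; h (false , h∈B) → ≤-trans (supp-upper B h∈B) (y≤x∨y _ _) })
    (∨-least (supp-least A (λ a a∈A → supp-upper (A ∪ B) (true , a∈A)))
             (supp-least B (λ b b∈B → supp-upper (A ∪ B) (false , b∈B))))

  supp-∼-⊙ : ∀ A B → supp (∼ A ⊙ B) ≡ π (supp A ᗮ) (supp B)
  supp-∼-⊙ A B = ≤-antisym
    (supp-least (∼ A ⊙ B) λ { h (a , b , a≗πₘ , b∈B , h≗) → begin
      h 𝟙         ≡⟨ trans (h≗ 𝟙) (a≗πₘ (b 𝟙)) ⟩
      π m (b 𝟙)   ≤⟨ adjoint-monotone (π-selfAdjoint m) (supp-upper B b∈B) ⟩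
      π m (supp B) ∎ })
    (supp-⊙-apply (∼ A) B {π m} (λ _ → refl))
    where
      open ≤-Reasoning
      m : M
      m = supp A ᗮ

module PowerSetQuantale {𝓜 : CompleteOrthomodularLattice} (𝓛 : InvolutiveSubmonoidWithSasaki 𝓜) where
  open CompleteOrthomodularLattice 𝓜 using (M; _∨_; _ᗮ; π; involutive)
  open PowerSet 𝓛
  open OrthomodularLatticeProperties 𝓜
  open Support 𝓛

  ⊆-isPartialOrder : IsPartialOrder _≐_ _⊆_
  ⊆-isPartialOrder = record
    { isPreorder = record
        { isEquivalence = record
            { refl  = (λ _ p → p) , (λ _ p → p)
            ; sym   = λ (A⊆B , B⊆A) → B⊆A , A⊆B
            ; trans = λ (A⊆B , B⊆A) (B⊆C , C⊆B) →
                        (λ f p → B⊆C f (A⊆B f p)) , (λ f p → B⊆A f (C⊆B f p)) }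
        ; reflexive = proj₁
        ; trans     = λ A⊆B B⊆C f p → B⊆C f (A⊆B f p) }
    ; antisym = _,_ }

  ⋃-upper : ∀ {I : Set} (A : I → 𝒫L) i → A i ⊆ ⋃ A
  ⋃-upper A i f p = i , p

  ⋃-least : ∀ {I : Set} (A : I → 𝒫L) B → (∀ i → A i ⊆ B) → ⋃ A ⊆ B
  ⋃-least A B Aᵢ⊆B f (i , p) = Aᵢ⊆B i f p

  ⊙-cong : ∀ {A A' B B'} → A ≐ A' → B ≐ B' → (A ⊙ B) ≐ (A' ⊙ B')
  ⊙-cong (A⊆A' , A'⊆A) (B⊆B' , B'⊆B) =
      (λ { h (a , b , p , q , e) → a , b , A⊆A' a p , B⊆B' b q , e })
    , (λ { h (a , b , p , q , e) → a , b , A'⊆A a p , B'⊆B b q , e })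

  *-cong : ∀ {A A'} → A ≐ A' → (A *) ≐ (A' *)
  *-cong (A⊆A' , A'⊆A) = (λ { g (a , p , adj) → a , A⊆A' a p , adj })
                       , (λ { g (a , p , adj) → a , A'⊆A a p , adj })

  ∼-cong : ∀ {A A'} → A ≐ A' → ∼ A ≐ ∼ A'
  ∼-cong {A} {A'} A≐A' = ∼-cong-supp A A' (supp-cong {A} {A'} A≐A')

  ⊙-assoc : ∀ A B C → ((A ⊙ B) ⊙ C) ≐ (A ⊙ (B ⊙ C))
  ⊙-assoc A B C =
      (λ { h (_ , c , (a , b , p , q , e') , r , e) →
             a , b ∘ c , p , (b , c , q , r , λ _ → refl) , λ t → trans (e t) (e' (c t)) })
    , (λ { h (a , _ , p , (b , c , q , r , e') , e) →
             a ∘ b , c , (a , b , p , q , λ _ → refl) , r , λ t → trans (e t) (cong a (e' t)) })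

  ⊙-identityˡ : ∀ A → (ε ⊙ A) ≐ A
  ⊙-identityˡ A =
      (λ { h (a , b , a≗id , q , e) → ∋-ext A (λ t → sym (trans (e t) (a≗id (b t)))) q })
    , (λ h q → id , h , (λ _ → refl) , q , λ _ → refl)

  ⊙-identityʳ : ∀ A → (A ⊙ ε) ≐ A
  ⊙-identityʳ A =
      (λ { h (a , b , p , b≗id , e) → ∋-ext A (λ t → sym (trans (e t) (cong a (b≗id t)))) p })
    , (λ h p → h , id , p , (λ _ → refl) , λ _ → refl)

  ⊙-distribˡ-⋃ : ∀ {I : Set} A (B : I → 𝒫L) → (A ⊙ ⋃ B) ≐ ⋃ (λ i → A ⊙ B i)
  ⊙-distribˡ-⋃ A B = (λ { h (a , b , p , (i , q) , e) → i , (a , b , p , q , e) })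
                   , (λ { h (i , (a , b , p , q , e)) → a , b , p , (i , q) , e })

  ⊙-distribʳ-⋃ : ∀ {I : Set} (A : I → 𝒫L) B → (⋃ A ⊙ B) ≐ ⋃ (λ i → A i ⊙ B)
  ⊙-distribʳ-⋃ A B = (λ { h (a , b , (i , p) , q , e) → i , (a , b , p , q , e) })
                   , (λ { h (i , (a , b , p , q , e)) → a , b , (i , p) , q , e })

  *-involutive : ∀ A → ((A *) *) ≐ A
  *-involutive A =
      (λ { h (g , (a , p , adj₁) , adj₂) → ∋-ext A (adjoint-unique (IsAdjoint-sym adj₁) adj₂) p })
    , (λ h p → let (h* , adj) = ∋-linear A p in h* , (h , p , adj) , IsAdjoint-sym adj)

  *-antihom : ∀ A B → ((A ⊙ B) *) ≐ ((B *) ⊙ (A *))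
  *-antihom A B =
      (λ { g (h , (a , b , p , q , e) , adj) →
             let (a* , adja) = ∋-linear A p
                 (b* , adjb) = ∋-linear B q
             in b* , a* , (b , q , adjb) , (a , p , adja) ,
                adjoint-unique (IsAdjoint-respˡ e adj) (IsAdjoint-∘ adja adjb) })
    , (λ { h (_ , _ , (b , q , adjb) , (a , p , adja) , e) →
             a ∘ b , (a , b , p , q , λ _ → refl) ,
             IsAdjoint-respʳ (λ t → sym (e t)) (IsAdjoint-∘ adja adjb) })

  *-⋃ : ∀ {I : Set} (A : I → 𝒫L) → (⋃ A *) ≐ ⋃ (λ i → A i *)
  *-⋃ A = (λ { g (a , (i , p) , adj) → i , (a , p , adj) })
        , (λ { g (i , (a , p , adj)) → a , (i , p) , adj })

  ∼-⊙-∼∼ : ∀ A B → ∼ (A ⊙ ∼ (∼ B)) ≐ ∼ (A ⊙ B)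
  ∼-⊙-∼∼ A B = ∼-cong-supp (A ⊙ ∼ (∼ B)) (A ⊙ B) (supp-⊙-congʳ A {∼ (∼ B)} {B} (supp-∼∼ B))

  ∼-⋃-∼∼ : ∀ {I : Set} (A : I → 𝒫L) → ∼ (⋃ (λ i → ∼ (∼ (A i)))) ≐ ∼ (⋃ A)
  ∼-⋃-∼∼ A = ∼-cong-supp (⋃ (λ i → ∼ (∼ (A i)))) (⋃ A)
    (supp-⋃-cong {A = λ i → ∼ (∼ (A i))} {A} (λ i → supp-∼∼ (A i)))

  ∼-selfAdjoint : ∀ A → (∼ A *) ≐ ∼ A
  ∼-selfAdjoint A =
      (λ { g (a , a≗ , adj) → adjoint-unique (IsAdjoint-respˡ a≗ adj) (π-selfAdjoint _) })
    , (λ g g≗ → _ , (λ _ → refl) , IsAdjoint-respʳ (λ x → sym (g≗ x)) (π-selfAdjoint _))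

  ∼∼-⊙ : ∀ A B → ∼ (∼ (∼ (∼ A) ⊙ B)) ≐ ∼ (∼ A ∪ ∼ (∼ A ∪ B))
  ∼∼-⊙ A B = ∼-cong-supp (∼ (∼ (∼ A) ⊙ B)) (∼ A ∪ ∼ (∼ A ∪ B)) (begin
    supp (∼ (∼ (∼ A) ⊙ B))                 ≡⟨ supp-∼ (∼ (∼ A) ⊙ B) ⟩
    supp (∼ (∼ A) ⊙ B) ᗮ                   ≡⟨ cong _ᗮ (supp-∼-⊙ (∼ A) B) ⟩
    π (supp (∼ A) ᗮ) (supp B) ᗮ            ≡⟨ cong (λ m → π m (supp B) ᗮ) sᗮᗮ ⟩
    π s (supp B) ᗮ                         ≡⟨ ᗮ-∧ s _ ⟩
    s ᗮ ∨ (s ᗮ ∨ supp B) ᗮ                 ≡⟨ cong (λ t → t ∨ (t ∨ supp B) ᗮ) (supp-∼ A) ⟨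
    supp (∼ A) ∨ (supp (∼ A) ∨ supp B) ᗮ   ≡⟨ cong (λ t → supp (∼ A) ∨ t ᗮ) (supp-∪ (∼ A) B) ⟨
    supp (∼ A) ∨ supp (∼ A ∪ B) ᗮ          ≡⟨ cong (supp (∼ A) ∨_) (supp-∼ (∼ A ∪ B)) ⟨
    supp (∼ A) ∨ supp (∼ (∼ A ∪ B))        ≡⟨ supp-∪ (∼ A) _ ⟨
    supp (∼ A ∪ ∼ (∼ A ∪ B))               ∎)
    where
      open ≡-Reasoning
      s : M
      s = supp A
      sᗮᗮ : supp (∼ A) ᗮ ≡ s
      sᗮᗮ = trans (cong _ᗮ (supp-∼ A)) (involutive s)

lemma3p9 : (𝓜 : CompleteOrthomodularLattice) (𝓛 : InvolutiveSubmonoidWithSasaki 𝓜) →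
    let open PowerSet 𝓛 in
    IsInvolutiveGDA _≐_ _⊆_ ⋃ _⊙_ _* ∼ ε
lemma3p9 𝓜 𝓛 = record
  { isPartialOrder = ⊆-isPartialOrder
  ; ⨆-upper        = ⋃-upper
  ; ⨆-least        = ⋃-least
  ; ⊙-cong         = λ {A} {A'} {B} {B'} → ⊙-cong {A} {A'} {B} {B'}
  ; *-cong         = λ {A} {A'} → *-cong {A} {A'}
  ; ∼-cong         = λ {A} {A'} → ∼-cong {A} {A'}
  ; ⊙-assoc        = ⊙-assoc
  ; ⊙-identityˡ    = ⊙-identityˡ
  ; ⊙-identityʳ    = ⊙-identityʳ
  ; ⊙-distribˡ-⨆   = ⊙-distribˡ-⋃
  ; ⊙-distribʳ-⨆   = ⊙-distribʳ-⋃
  ; *-involutive   = *-involutive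
  ; *-antihom      = *-antihom
  ; *-⨆            = *-⋃
  ; ax-i           = ∼-⊙-∼∼
  ; ax-ii          = ∼-⋃-∼∼
  ; ax-iii         = ∼-selfAdjoint
  ; ax-iv          = ∼∼-⊙
  }
  where open PowerSetQuantale 𝓛
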